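{- If $(t_k)$ and $(\tau_k)$, $k=0,1,2,\ldots$, are a binomial-transform pair of the first kind, then so are the sequences \[ a_k=\sum_{j=1}^{k-1+\delta_{k0}}t_{j-1}\quad\text{and}\quad \alpha_k=\sum_{j=1}^{k-1+\delta_{k0}}\tau_{j-1},\qquad k=0,1,2,\ldots; \] so that, for every positive integer $n$, \[ \sum_{k=1}^n(-1)^k\binom nk\sum_{j=1}^{k-1}t_{j-1}=\sum_{k=1}^{n-1}\tau_{k-1}. \]
   Context: Two sequences $(t_k)_{k\ge0}$ and $(\tau_k)_{k\ge0}$ of complex numbers form a binomial-transform pair of the first kind if $\tau_n=\sum_{k=0}^n(-1)^k\binom nk t_k$ for every non-negative integer $n$. $\delta_{ij}$ is the Kronecker delta; an empty sum (upper limit smaller than lower limit) equals $0$. -}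

module Defs where

open import Level using (Level)
open import Data.Nat using (ℕ; zero; suc; _∸_) renaming (_+_ to _+ℕ_)
open import Data.Nat.Combinatorics using (_C_)
open import Algebra.Bundles using (CommutativeRing)

δ : ℕ → ℕ → ℕ
δ zero    zero    = 1
δ zero    (suc _) = 0
δ (suc _) zero    = 0
δ (suc i) (suc j) = δ i j

module _ {c ℓ : Level} (R : CommutativeRing c ℓ) where
  open CommutativeRing R

  ι : ℕ → Carrier
  ι zero    = 0#
  ι (suc n) = 1# + ι n

  sgn : ℕ → Carrier
  sgn zero    = 1#
  sgn (suc k) = - sgn k

  binom : ℕ → ℕ → Carrier
  binom n k = ι (n C k)

  sumBelow : ℕ → (ℕ → Carrier) → Carrier
  sumBelow zero    f = 0#
  sumBelow (suc m) f = sumBelow m f + f m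

  -- Σ_{j=lo}^{hi} f j ; empty (= 0) when hi < lo
  sumFT : ℕ → ℕ → (ℕ → Carrier) → Carrier
  sumFT lo hi f = sumBelow (suc hi ∸ lo) (λ i → f (lo +ℕ i))

  BinomialPair : (ℕ → Carrier) → (ℕ → Carrier) → Set ℓ
  BinomialPair t τ = ∀ n → τ n ≈ sumFT 0 n (λ k → sgn k * (binom n k * t k))

  -- a_k = Σ_{j=1}^{k-1+δ_{k0}} t_{j-1}
  -- (the integer upper limit k-1+δ_{k0} is always ≥ 0, so it equals (k + δ k 0) ∸ 1)
  shiftSum : (ℕ → Carrier) → ℕ → Carrier
  shiftSum t k = sumFT 1 ((k +ℕ δ k 0) ∸ 1) (λ j → t (j ∸ 1))

{-# OPTIONS --safe #-}
module Submission where

-- Pascal's rule makes the binomial transform T satisfy T f (n+1) = T f n − T (f ∘ suc) n.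
-- Consequently T intertwines the partial-sum operator Σ and the one-step delay D (which
-- prepends a 0) up to sign: T (Σ g) = − D (T g) and T (D f) = − Σ (T f). Since
-- a = D (Σ t), this gives T a = − Σ (T (Σ t)) = Σ (D (T t)) = D (Σ τ) = α.

open import Defs
open import Level using (Level)
open import Function using (_∘_)
open import Data.Nat using (ℕ; zero; suc; _∸_; _≤_; z≤n; s≤s) renaming (_+_ to _+ℕ_)
open import Data.Nat.Properties using (n<1+n) renaming (+-identityʳ to +ℕ-identityʳ)
open import Data.Nat.Combinatorics
  using (_C_; nCk+nC[k+1]≡[n+1]C[k+1]; k>n⇒nCk≡0; nCk≡nC[n∸k]; nCn≡1)
open import Data.Product using (_×_; _,_)
open import Algebra.Bundles using (CommutativeRing)
import Relation.Binary.PropositionalEquality as ≡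
import Relation.Binary.Reasoning.Setoid as SetoidReasoning

module _ {c ℓ : Level} (R : CommutativeRing c ℓ) where
  open CommutativeRing R
  open SetoidReasoning setoid
  open import Algebra.Properties.Group +-group using (ε⁻¹≈ε; ⁻¹-involutive; \\-leftDividesˡ)
  open import Algebra.Properties.AbelianGroup +-abelianGroup using (⁻¹-∙-comm)
  open import Algebra.Properties.CommutativeSemigroup +-commutativeSemigroup using (interchange)
  open import Algebra.Properties.Ring ring using (-‿distribˡ-*)

  sumBelow-cong : ∀ m {f g : ℕ → Carrier} → (∀ i → f i ≈ g i) → sumBelow R m f ≈ sumBelow R m g
  sumBelow-cong zero    f≈g = refl
  sumBelow-cong (suc m) f≈g = +-cong (sumBelow-cong m f≈g) (f≈g m)

  sumBelow-+ : ∀ m (f g : ℕ → Carrier) →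
               sumBelow R m (λ i → f i + g i) ≈ sumBelow R m f + sumBelow R m g
  sumBelow-+ zero    f g = sym (+-identityˡ 0#)
  sumBelow-+ (suc m) f g = trans (+-congʳ (sumBelow-+ m f g)) (interchange _ _ _ _)

  sumBelow-neg : ∀ m (f : ℕ → Carrier) → sumBelow R m (λ i → - f i) ≈ - sumBelow R m f
  sumBelow-neg zero    f = sym ε⁻¹≈ε
  sumBelow-neg (suc m) f = trans (+-congʳ (sumBelow-neg m f)) (⁻¹-∙-comm _ _)

  sumBelow-suc-head : ∀ m (f : ℕ → Carrier) → sumBelow R (suc m) f ≈ f 0 + sumBelow R m (f ∘ suc)
  sumBelow-suc-head zero    f = trans (+-identityˡ _) (sym (+-identityʳ _))
  sumBelow-suc-head (suc m) f = trans (+-congʳ (sumBelow-suc-head m f)) (+-assoc _ _ _)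

  ι-+ : ∀ m n → ι R (m +ℕ n) ≈ ι R m + ι R n
  ι-+ zero    n = sym (+-identityˡ _)
  ι-+ (suc m) n = trans (+-congˡ (ι-+ m n)) (sym (+-assoc _ _ _))

  binom-zero : ∀ n → binom R n 0 ≈ 1#
  binom-zero n = trans (reflexive (≡.cong (ι R) (≡.trans (nCk≡nC[n∸k] (z≤n {n})) (nCn≡1 n))))
                       (+-identityʳ 1#)

  binom-pascal : ∀ n k → binom R (suc n) (suc k) ≈ binom R n k + binom R n (suc k)
  binom-pascal n k = trans (reflexive (≡.cong (ι R) (≡.sym (nCk+nC[k+1]≡[n+1]C[k+1] n k))))
                           (ι-+ (n C k) (n C suc k))

  transformTerm : ℕ → (ℕ → Carrier) → ℕ → Carrier
  transformTerm n f k = sgn R k * (binom R n k * f k)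

  binomialTransform : (ℕ → Carrier) → ℕ → Carrier
  binomialTransform f n = sumFT R 0 n (transformTerm n f)

  transformTerm-zero : ∀ n f → transformTerm n f 0 ≈ f 0
  transformTerm-zero n f = trans (*-identityˡ _) (trans (*-congʳ (binom-zero n)) (*-identityˡ _))

  transformTerm-beyond : ∀ n f → transformTerm n f (suc n) ≈ 0#
  transformTerm-beyond n f = begin
    sgn R (suc n) * (ι R (n C suc n) * f (suc n))
      ≈⟨ *-congˡ (*-congʳ (reflexive (≡.cong (ι R) (k>n⇒nCk≡0 (n<1+n n))))) ⟩
    sgn R (suc n) * (0# * f (suc n))
      ≈⟨ trans (*-congˡ (zeroˡ _)) (zeroʳ _) ⟩
    0# ∎

  transformTerm-pascal : ∀ f n k →
    transformTerm (suc n) f (suc k) ≈ transformTerm n f (suc k) - transformTerm n (f ∘ suc) k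
  transformTerm-pascal f n k = begin
    - s * (binom R (suc n) (suc k) * x)       ≈⟨ *-congˡ (*-congʳ (binom-pascal n k)) ⟩
    - s * ((b + b′) * x)                      ≈⟨ *-congˡ (distribʳ x b b′) ⟩
    - s * (b * x + b′ * x)                    ≈⟨ distribˡ (- s) _ _ ⟩
    - s * (b * x) + - s * (b′ * x)            ≈⟨ +-comm _ _ ⟩
    - s * (b′ * x) + - s * (b * x)            ≈⟨ +-congˡ (-‿distribˡ-* s (b * x)) ⟨
    - s * (b′ * x) - s * (b * x)              ∎
    where
    s b b′ x : Carrier
    s = sgn R k
    b = binom R n k
    b′ = binom R n (suc k)
    x = f (suc k)

  binomialTransform-cong : ∀ {f g} → (∀ k → f k ≈ g k) → ∀ n → binomialTransform f n ≈ binomialTransform g n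
  binomialTransform-cong f≈g n = sumBelow-cong (suc n) (λ k → *-congˡ (*-congˡ (f≈g k)))

  binomialTransform-+ : ∀ f g n →
    binomialTransform (λ k → f k + g k) n ≈ binomialTransform f n + binomialTransform g n
  binomialTransform-+ f g n = trans
    (sumBelow-cong (suc n) (λ k → trans (*-congˡ (distribˡ _ _ _)) (distribˡ _ _ _)))
    (sumBelow-+ (suc n) _ _)

  binomialTransform-zero : ∀ f → binomialTransform f 0 ≈ f 0
  binomialTransform-zero f = trans (+-identityˡ _) (transformTerm-zero 0 f)

  binomialTransform-suc : ∀ f n →
    binomialTransform f (suc n) ≈ binomialTransform f n - binomialTransform (f ∘ suc) n
  binomialTransform-suc f n = begin
    sumBelow R (suc (suc n)) (transformTerm (suc n) f)
      ≈⟨ sumBelow-suc-head (suc n) _ ⟩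
    transformTerm (suc n) f 0 + sumBelow R (suc n) (transformTerm (suc n) f ∘ suc)
      ≈⟨ +-cong (trans (transformTerm-zero (suc n) f) (sym (transformTerm-zero n f)))
                (sumBelow-cong (suc n) (transformTerm-pascal f n)) ⟩
    G 0 + sumBelow R (suc n) (λ k → G (suc k) - transformTerm n (f ∘ suc) k)
      ≈⟨ +-congˡ (trans (sumBelow-+ (suc n) _ _) (+-congˡ (sumBelow-neg (suc n) _))) ⟩
    G 0 + (sumBelow R (suc n) (G ∘ suc) - binomialTransform (f ∘ suc) n)
      ≈⟨ sym (+-assoc _ _ _) ⟩
    (G 0 + sumBelow R (suc n) (G ∘ suc)) - binomialTransform (f ∘ suc) n
      ≈⟨ +-congʳ (sym (sumBelow-suc-head (suc n) G)) ⟩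
    (binomialTransform f n + G (suc n)) - binomialTransform (f ∘ suc) n
      ≈⟨ +-congʳ (trans (+-congˡ (transformTerm-beyond n f)) (+-identityʳ _)) ⟩
    binomialTransform f n - binomialTransform (f ∘ suc) n ∎
    where
    G : ℕ → Carrier
    G = transformTerm n f

  binomialTransform-from1 : ∀ {f} → f 0 ≈ 0# → ∀ n →
    binomialTransform f n ≈ sumFT R 1 n (transformTerm n f)
  binomialTransform-from1 {f} f0≈0 n = trans (sumBelow-suc-head n _)
    (trans (+-congʳ (trans (transformTerm-zero n f) f0≈0)) (+-identityˡ _))

  partialSums : (ℕ → Carrier) → ℕ → Carrier
  partialSums f k = sumBelow R k f

  delay : (ℕ → Carrier) → ℕ → Carrier
  delay f zero    = 0#
  delay f (suc k) = f k

  delay-cong : ∀ {f g} → (∀ k → f k ≈ g k) → ∀ k → delay f k ≈ delay g k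
  delay-cong f≈g zero    = refl
  delay-cong f≈g (suc k) = f≈g k

  partialSums-delay : ∀ f k → partialSums (delay f) k ≈ delay (partialSums f) k
  partialSums-delay f zero    = refl
  partialSums-delay f (suc k) = trans (sumBelow-suc-head k (delay f)) (+-identityˡ _)

  shiftSum-suc : ∀ f m → shiftSum R f (suc m) ≈ partialSums f m
  shiftSum-suc f m = reflexive (≡.cong (λ i → sumBelow R i f) (+ℕ-identityʳ m))

  shiftSum-delay : ∀ f k → shiftSum R f k ≈ delay (partialSums f) k
  shiftSum-delay f zero    = refl
  shiftSum-delay f (suc m) = shiftSum-suc f m

  binomialTransform-partialSums : ∀ g n →
    binomialTransform (partialSums g) n ≈ - delay (binomialTransform g) n
  binomialTransform-partialSums g zero    = trans (binomialTransform-zero (partialSums g)) (sym ε⁻¹≈ε)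
  binomialTransform-partialSums g (suc n) = begin
    binomialTransform (partialSums g) (suc n)
      ≈⟨ binomialTransform-suc (partialSums g) n ⟩
    S - binomialTransform (λ k → partialSums g k + g k) n
      ≈⟨ +-congˡ (-‿cong (binomialTransform-+ (partialSums g) g n)) ⟩
    S - (S + binomialTransform g n)
      ≈⟨ +-congˡ (⁻¹-∙-comm S _) ⟨
    S + (- S - binomialTransform g n)
      ≈⟨ \\-leftDividesˡ S _ ⟩
    - binomialTransform g n ∎
    where
    S : Carrier
    S = binomialTransform (partialSums g) n

  binomialTransform-delay : ∀ f n →
    binomialTransform (delay f) n ≈ - partialSums (binomialTransform f) n
  binomialTransform-delay f zero    = trans (binomialTransform-zero (delay f)) (sym ε⁻¹≈ε)
  binomialTransform-delay f (suc n) = begin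
    binomialTransform (delay f) (suc n)
      ≈⟨ binomialTransform-suc (delay f) n ⟩
    binomialTransform (delay f) n - binomialTransform f n
      ≈⟨ +-congʳ (binomialTransform-delay f n) ⟩
    - partialSums (binomialTransform f) n - binomialTransform f n
      ≈⟨ ⁻¹-∙-comm _ _ ⟩
    - partialSums (binomialTransform f) (suc n) ∎

  shiftSum-binomialPair : ∀ {t τ} → BinomialPair R t τ → BinomialPair R (shiftSum R t) (shiftSum R τ)
  shiftSum-binomialPair {t} {τ} pair n = sym (begin
    binomialTransform (shiftSum R t) n
      ≈⟨ binomialTransform-cong (shiftSum-delay t) n ⟩
    binomialTransform (delay (partialSums t)) n
      ≈⟨ binomialTransform-delay (partialSums t) n ⟩
    - partialSums (binomialTransform (partialSums t)) n
      ≈⟨ -‿cong (sumBelow-cong n (binomialTransform-partialSums t)) ⟩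
    - sumBelow R n (λ k → - delay (binomialTransform t) k)
      ≈⟨ trans (-‿cong (sumBelow-neg n _)) (⁻¹-involutive _) ⟩
    partialSums (delay (binomialTransform t)) n
      ≈⟨ sumBelow-cong n (delay-cong (λ k → sym (pair k))) ⟩
    partialSums (delay τ) n
      ≈⟨ partialSums-delay τ n ⟩
    delay (partialSums τ) n
      ≈⟨ shiftSum-delay τ n ⟨
    shiftSum R τ n ∎)

theorem15 : ∀ {c ℓ} (R : CommutativeRing c ℓ) (t τ : ℕ → CommutativeRing.Carrier R) →
    BinomialPair R t τ →
    BinomialPair R (shiftSum R t) (shiftSum R τ) ×
    (∀ n → 1 ≤ n →
      CommutativeRing._≈_ R
        (sumFT R 1 n (λ k → CommutativeRing._*_ R (sgn R k) (CommutativeRing._*_ R (binom R n k) (sumFT R 1 (k ∸ 1) (λ j → t (j ∸ 1))))))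
        (sumFT R 1 (n ∸ 1) (λ k → τ (k ∸ 1))))
theorem15 R t τ pair = shiftSum-binomialPair R pair , λ { (suc m) (s≤s _) → explicitForm m }
  where
  open CommutativeRing R
  open SetoidReasoning setoid

  explicitForm : ∀ m → sumFT R 1 (suc m) (transformTerm R (suc m) (λ k → sumFT R 1 (k ∸ 1) (λ j → t (j ∸ 1))))
    ≈ sumFT R 1 m (λ k → τ (k ∸ 1))
  explicitForm m = begin
    sumFT R 1 (suc m) (transformTerm R (suc m) (λ k → sumFT R 1 (k ∸ 1) (λ j → t (j ∸ 1))))
      ≈⟨ sumBelow-cong R (suc m) (λ k → *-congˡ (*-congˡ (shiftSum-suc R t k))) ⟨
    sumFT R 1 (suc m) (transformTerm R (suc m) (shiftSum R t))
      ≈⟨ binomialTransform-from1 R refl (suc m) ⟨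
    binomialTransform R (shiftSum R t) (suc m)
      ≈⟨ shiftSum-binomialPair R pair (suc m) ⟨
    shiftSum R τ (suc m)
      ≈⟨ shiftSum-suc R τ m ⟩
    sumFT R 1 m (λ k → τ (k ∸ 1)) ∎
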